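{- Let $\Sigma$ be a commutable set. In $\mathcal{T}\ddot\Sigma$, the terms $0$ and $1$ have bounded output; if $e_1,e_2$ have bounded output then so do $e_1+e_2$ and $e_1e_2$; and if $e$ has bounded output and every string $s\le e$ satisfies $|\pi_l(s)|\ge1$, then $e^*$ has bounded output.
   Context: Pre-Kleene algebra: constants $0,1$, operations $+,\cdot,{}^*$ with $(+,0)$ a commutative idempotent monoid, $(\cdot,1)$ a monoid, two-sided distributivity, $0$ absorbing, and $x^*=1+xx^*$; order $x\le y$ iff $x+y=y$. A commutable set is a set with a reflexive symmetric relation $\sim$. $\mathcal{S}Y$: strings over $Y$ modulo $xy=yx$ for $x\sim y$, $|s|$ the length; $\mathcal{T}Y$: free pre-Kleene algebra on $Y$ subject to $xy=yx$ for $x\sim y$, containing $\mathcal{S}Y$. $\ddot\Sigma=\{x_l\}\cup\{x_r\}$ ($x\in\Sigma$) with $x_l\sim y_r$ always, $x_l\sim y_l$ iff $x\sim y$, $x_r\sim y_r$ iff $x\sim y$. $\pi_l,\pi_r:\mathcal{T}\ddot\Sigma\to\mathcal{T}\Sigma$ are morphisms with $\pi_l(x_l)=x,\pi_l(x_r)=1$, $\pi_r(x_r)=x,\pi_r(x_l)=1$ (mapping strings to strings). A term $e\in\mathcal{T}\ddot\Sigma$ has bounded output if there is $k\in\mathbb{N}$ (a fanout) such that every string $s\in\mathcal{S}\ddot\Sigma$ with $s\le e$ satisfies $|\pi_r(s)|\le(|\pi_l(s)|+1)k$. -}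

module Defs where

open import Data.Nat using (ℕ; zero; suc; _+_; _*_; _≤_)
open import Data.List using (List; []; _∷_; length)
open import Data.Product using (Σ; ∃; _×_; _,_)

record CommutableSet : Set₁ where
  field
    Carrier : Set
    _∼_     : Carrier → Carrier → Set
    ∼-refl  : ∀ x → x ∼ x
    ∼-sym   : ∀ {x y} → x ∼ y → y ∼ x

-- 𝒯Y : free pre-Kleene algebra on Y subject to xy = yx for x ∼ y.
-- Presented as syntax modulo the congruence generated by the axioms.

module FreePKA (Y : CommutableSet) where
  open CommutableSet Y

  infixl 6 _⊕_
  infixl 7 _⊙_
  infix  8 _⋆

  data Term : Set where
    𝟘 𝟙  : Term
    var  : Carrier → Term
    _⊕_  : Term → Term → Term
    _⊙_  : Term → Term → Term
    _⋆   : Term → Term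

  infix 4 _≈_
  data _≈_ : Term → Term → Set where
    ≈-refl  : ∀ {x} → x ≈ x
    ≈-sym   : ∀ {x y} → x ≈ y → y ≈ x
    ≈-trans : ∀ {x y z} → x ≈ y → y ≈ z → x ≈ z
    ⊕-cong  : ∀ {x x′ y y′} → x ≈ x′ → y ≈ y′ → x ⊕ y ≈ x′ ⊕ y′
    ⊙-cong  : ∀ {x x′ y y′} → x ≈ x′ → y ≈ y′ → x ⊙ y ≈ x′ ⊙ y′
    ⋆-cong  : ∀ {x x′} → x ≈ x′ → x ⋆ ≈ x′ ⋆
    ⊕-assoc : ∀ x y z → (x ⊕ y) ⊕ z ≈ x ⊕ (y ⊕ z)
    ⊕-comm  : ∀ x y → x ⊕ y ≈ y ⊕ x
    ⊕-idem  : ∀ x → x ⊕ x ≈ x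
    ⊕-idˡ   : ∀ x → 𝟘 ⊕ x ≈ x
    ⊙-assoc : ∀ x y z → (x ⊙ y) ⊙ z ≈ x ⊙ (y ⊙ z)
    ⊙-idˡ   : ∀ x → 𝟙 ⊙ x ≈ x
    ⊙-idʳ   : ∀ x → x ⊙ 𝟙 ≈ x
    distribˡ : ∀ x y z → x ⊙ (y ⊕ z) ≈ x ⊙ y ⊕ x ⊙ z
    distribʳ : ∀ x y z → (y ⊕ z) ⊙ x ≈ y ⊙ x ⊕ z ⊙ x
    zeroˡ   : ∀ x → 𝟘 ⊙ x ≈ 𝟘
    zeroʳ   : ∀ x → x ⊙ 𝟘 ≈ 𝟘
    ⋆-unfold : ∀ x → x ⋆ ≈ 𝟙 ⊕ x ⊙ x ⋆
    comm    : ∀ {a b} → a ∼ b → var a ⊙ var b ≈ var b ⊙ var a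

  infix 4 _≤ᵀ_
  _≤ᵀ_ : Term → Term → Set
  x ≤ᵀ y = x ⊕ y ≈ y

  -- strings (elements of 𝒮Y, represented by lists; commutation is
  -- accounted for by the equivalence ≈ above) embedded into 𝒯Y
  ⟦_⟧ : List Carrier → Term
  ⟦ [] ⟧    = 𝟙
  ⟦ a ∷ s ⟧ = var a ⊙ ⟦ s ⟧

data Side : Set where
  l r : Side

module Doubled (Sg : CommutableSet) where
  open CommutableSet Sg renaming (Carrier to A; _∼_ to _∼Σ_)

  data Letter : Set where
    _ₗ _ᵣ : A → Letter

  data _∼̈_ : Letter → Letter → Set where
    lr : ∀ {x y} → (x ₗ) ∼̈ (y ᵣ)
    rl : ∀ {x y} → (x ᵣ) ∼̈ (y ₗ)
    ll : ∀ {x y} → x ∼Σ y → (x ₗ) ∼̈ (y ₗ)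
    rr : ∀ {x y} → x ∼Σ y → (x ᵣ) ∼̈ (y ᵣ)

  ∼̈-refl : ∀ a → a ∼̈ a
  ∼̈-refl (x ₗ) = ll (∼-refl x)
  ∼̈-refl (x ᵣ) = rr (∼-refl x)

  ∼̈-sym : ∀ {a b} → a ∼̈ b → b ∼̈ a
  ∼̈-sym lr = rl
  ∼̈-sym rl = lr
  ∼̈-sym (ll p) = ll (∼-sym p)
  ∼̈-sym (rr p) = rr (∼-sym p)

  Σ̈ : CommutableSet
  Σ̈ = record { Carrier = Letter ; _∼_ = _∼̈_ ; ∼-refl = ∼̈-refl ; ∼-sym = ∼̈-sym }

  open FreePKA Σ̈ public

  -- π_l, π_r restricted to strings (they map strings to strings)
  πₗ : List Letter → List A
  πₗ []          = []
  πₗ ((x ₗ) ∷ s) = x ∷ πₗ s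
  πₗ ((x ᵣ) ∷ s) = πₗ s

  πᵣ : List Letter → List A
  πᵣ []          = []
  πᵣ ((x ₗ) ∷ s) = πᵣ s
  πᵣ ((x ᵣ) ∷ s) = x ∷ πᵣ s

  HasFanout : Term → ℕ → Set
  HasFanout e k = ∀ (s : List Letter) → ⟦ s ⟧ ≤ᵀ e →
                  length (πᵣ s) ≤ (length (πₗ s) + 1) * k

  BoundedOutput : Term → Set
  BoundedOutput e = Σ ℕ (HasFanout e)

-- Every term e is interpreted by its profile: the set of pairs (|πₗ s|, |πᵣ s|) for
-- the strings s ≤ e. Profiles form a commutative pre-Kleene algebra under union,
-- pointwise addition and its iteration, and equal terms have equal profiles, while
-- conversely every pair in the profile of e is realized by a string below e. So e has
-- fanout k exactly when its profile lies under the line o = (i + 1) k, and the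
-- closure properties become inequalities between natural numbers. For e* the pieces
-- have input length at least 1, so the fanout k of e bounds each piece by slope 2k.

module Submission where

open import Defs
open import Data.Nat using (ℕ; suc; _+_; _*_; _≤_; z≤n)
open import Data.Nat.Properties
open import Data.Nat.Tactic.RingSolver using (solve-∀)
open import Data.List using (List; []; _∷_; length; _++_)
open import Data.Product using (∃; _×_; _,_; proj₁; swap)
open import Data.Sum as Sum using (inj₁; inj₂; [_,_]′; assocʳ; assocˡ; reduce; fromInj₂)
open import Data.Empty using (⊥)
open import Function using (id; _∘_)
open import Level using (0ℓ)
open import Relation.Binary.Bundles using (Setoid)
open import Relation.Binary.Core using (REL; _⇒_; _⇔_)
open import Relation.Binary.Construct.Union using (_∪_)
open import Relation.Binary.PropositionalEquality

module FreePKAOrder (Y : CommutableSet) where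
  open FreePKA Y

  ≈-setoid : Setoid 0ℓ 0ℓ
  ≈-setoid = record
    { Carrier = Term
    ; _≈_ = _≈_
    ; isEquivalence = record { refl = ≈-refl ; sym = ≈-sym ; trans = ≈-trans }
    }

  open import Relation.Binary.Reasoning.Setoid ≈-setoid

  ≤ᵀ-refl : ∀ x → x ≤ᵀ x
  ≤ᵀ-refl = ⊕-idem

  ≤ᵀ-trans : ∀ {x y z} → x ≤ᵀ y → y ≤ᵀ z → x ≤ᵀ z
  ≤ᵀ-trans {x} {y} {z} x≤y y≤z = begin
    x ⊕ z        ≈⟨ ⊕-cong ≈-refl y≤z ⟨
    x ⊕ (y ⊕ z)  ≈⟨ ⊕-assoc x y z ⟨
    (x ⊕ y) ⊕ z  ≈⟨ ⊕-cong x≤y ≈-refl ⟩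
    y ⊕ z        ≈⟨ y≤z ⟩
    z            ∎

  ≤ᵀ-respˡ-≈ : ∀ {x x′ y} → x ≈ x′ → x ≤ᵀ y → x′ ≤ᵀ y
  ≤ᵀ-respˡ-≈ x≈x′ x≤y = ≈-trans (⊕-cong (≈-sym x≈x′) ≈-refl) x≤y

  ≤ᵀ-respʳ-≈ : ∀ {x y y′} → y ≈ y′ → x ≤ᵀ y → x ≤ᵀ y′
  ≤ᵀ-respʳ-≈ y≈y′ x≤y = ≈-trans (⊕-cong ≈-refl (≈-sym y≈y′)) (≈-trans x≤y y≈y′)

  x≤x⊕y : ∀ x y → x ≤ᵀ x ⊕ y
  x≤x⊕y x y = begin
    x ⊕ (x ⊕ y)  ≈⟨ ⊕-assoc x x y ⟨
    (x ⊕ x) ⊕ y  ≈⟨ ⊕-cong (⊕-idem x) ≈-refl ⟩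
    x ⊕ y        ∎

  y≤x⊕y : ∀ x y → y ≤ᵀ x ⊕ y
  y≤x⊕y x y = ≤ᵀ-respʳ-≈ (⊕-comm y x) (x≤x⊕y y x)

  ⊙-mono : ∀ {x x′ y y′} → x ≤ᵀ x′ → y ≤ᵀ y′ → x ⊙ y ≤ᵀ x′ ⊙ y′
  ⊙-mono {x} {x′} {y} {y′} x≤x′ y≤y′ = ≤ᵀ-trans
    (≈-trans (≈-sym (distribʳ y x x′)) (⊙-cong x≤x′ ≈-refl))
    (≈-trans (≈-sym (distribˡ x′ y y′)) (⊙-cong ≈-refl y≤y′))

  𝟙≤⋆ : ∀ x → 𝟙 ≤ᵀ x ⋆
  𝟙≤⋆ x = ≤ᵀ-respʳ-≈ (≈-sym (⋆-unfold x)) (x≤x⊕y 𝟙 (x ⊙ x ⋆))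

  x⊙x⋆≤x⋆ : ∀ x → x ⊙ x ⋆ ≤ᵀ x ⋆
  x⊙x⋆≤x⋆ x = ≤ᵀ-respʳ-≈ (≈-sym (⋆-unfold x)) (y≤x⊕y 𝟙 (x ⊙ x ⋆))

  ⟦⟧-++ : ∀ s t → ⟦ s ++ t ⟧ ≈ ⟦ s ⟧ ⊙ ⟦ t ⟧
  ⟦⟧-++ []      t = ≈-sym (⊙-idˡ ⟦ t ⟧)
  ⟦⟧-++ (a ∷ s) t = begin
    var a ⊙ ⟦ s ++ t ⟧         ≈⟨ ⊙-cong ≈-refl (⟦⟧-++ s t) ⟩
    var a ⊙ (⟦ s ⟧ ⊙ ⟦ t ⟧)    ≈⟨ ⊙-assoc (var a) ⟦ s ⟧ ⟦ t ⟧ ⟨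
    (var a ⊙ ⟦ s ⟧) ⊙ ⟦ t ⟧    ∎

Profiles : Set₁
Profiles = REL ℕ ℕ 0ℓ

data Unit : Profiles where
  unit : Unit 0 0

infixl 7 _∙_
infixr 5 _▸_ _∷_

data _∙_ (P Q : Profiles) : Profiles where
  _▸_ : ∀ {i₁ o₁ i₂ o₂} → P i₁ o₁ → Q i₂ o₂ → (P ∙ Q) (i₁ + i₂) (o₁ + o₂)

data Star (P : Profiles) : Profiles where
  []  : Star P 0 0
  _∷_ : ∀ {i₁ o₁ i₂ o₂} → P i₁ o₁ → Star P i₂ o₂ → Star P (i₁ + i₂) (o₁ + o₂)

⇔-trans : ∀ {P Q R : Profiles} → P ⇔ Q → Q ⇔ R → P ⇔ R
⇔-trans (to₁ , from₁) (to₂ , from₂) = to₂ ∘ to₁ , from₁ ∘ from₂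

∪-cong : ∀ {P P′ Q Q′ : Profiles} → P ⇔ P′ → Q ⇔ Q′ → P ∪ Q ⇔ P′ ∪ Q′
∪-cong (to₁ , from₁) (to₂ , from₂) = Sum.map to₁ to₂ , Sum.map from₁ from₂

∙-map : ∀ {P P′ Q Q′} → P ⇒ P′ → Q ⇒ Q′ → P ∙ Q ⇒ P′ ∙ Q′
∙-map f g (p ▸ q) = f p ▸ g q

∙-comm : ∀ {P Q} → P ∙ Q ⇒ Q ∙ P
∙-comm {P} {Q} (_▸_ {i₁} {o₁} {i₂} {o₂} p q) =
  subst₂ (Q ∙ P) (+-comm i₂ i₁) (+-comm o₂ o₁) (q ▸ p)

∙-assoc : ∀ {P Q R} → (P ∙ Q) ∙ R ⇔ P ∙ (Q ∙ R)
∙-assoc {P} {Q} {R} = to , from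
  where
  to : (P ∙ Q) ∙ R ⇒ P ∙ (Q ∙ R)
  to (_▸_ {i₂ = i₃} {o₂ = o₃} (_▸_ {i₁} {o₁} {i₂} {o₂} p q) u) =
    subst₂ (P ∙ (Q ∙ R)) (sym (+-assoc i₁ i₂ i₃)) (sym (+-assoc o₁ o₂ o₃)) (p ▸ q ▸ u)
  from : P ∙ (Q ∙ R) ⇒ (P ∙ Q) ∙ R
  from (_▸_ {i₁} {o₁} p (_▸_ {i₂} {o₂} {i₃} {o₃} q u)) =
    subst₂ ((P ∙ Q) ∙ R) (+-assoc i₁ i₂ i₃) (+-assoc o₁ o₂ o₃) ((p ▸ q) ▸ u)

∙-identityˡ : ∀ {P} → Unit ∙ P ⇔ P
∙-identityˡ = (λ { (unit ▸ p) → p }) , (unit ▸_)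

∙-identityʳ : ∀ {P} → P ∙ Unit ⇔ P
∙-identityʳ {P} = to , from
  where
  to : P ∙ Unit ⇒ P
  to (_▸_ {i} {o} p unit) = subst₂ P (sym (+-identityʳ i)) (sym (+-identityʳ o)) p
  from : P ⇒ P ∙ Unit
  from {i} {o} p = subst₂ (P ∙ Unit) (+-identityʳ i) (+-identityʳ o) (p ▸ unit)

∙-distribˡ-∪ : ∀ {P Q R} → P ∙ (Q ∪ R) ⇔ P ∙ Q ∪ P ∙ R
∙-distribˡ-∪ = (λ { (p ▸ inj₁ q) → inj₁ (p ▸ q) ; (p ▸ inj₂ u) → inj₂ (p ▸ u) })
             , [ ∙-map id inj₁ , ∙-map id inj₂ ]′

∙-distribʳ-∪ : ∀ {P Q R} → (Q ∪ R) ∙ P ⇔ Q ∙ P ∪ R ∙ P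
∙-distribʳ-∪ = (λ { (inj₁ q ▸ p) → inj₁ (q ▸ p) ; (inj₂ u ▸ p) → inj₂ (u ▸ p) })
             , [ ∙-map inj₁ id , ∙-map inj₂ id ]′

∙-cong : ∀ {P P′ Q Q′} → P ⇔ P′ → Q ⇔ Q′ → P ∙ Q ⇔ P′ ∙ Q′
∙-cong (to₁ , from₁) (to₂ , from₂) = ∙-map to₁ to₂ , ∙-map from₁ from₂

Star-map : ∀ {P Q} → P ⇒ Q → Star P ⇒ Star Q
Star-map f []       = []
Star-map f (p ∷ ps) = f p ∷ Star-map f ps

Star-cong : ∀ {P Q} → P ⇔ Q → Star P ⇔ Star Q
Star-cong (to , from) = Star-map to , Star-map from

Star-unfold : ∀ {P} → Star P ⇔ Unit ∪ P ∙ Star P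
Star-unfold = (λ { [] → inj₁ unit ; (p ∷ ps) → inj₂ (p ▸ ps) })
            , [ (λ { unit → [] }) , (λ { (p ▸ ps) → p ∷ ps }) ]′

Fanout : Profiles → ℕ → Set
Fanout P k = P ⇒ λ i o → o ≤ (i + 1) * k

Slope : Profiles → ℕ → Set
Slope P c = P ⇒ λ i o → o ≤ i * c

Fanout-mono : ∀ {P k k′} → k ≤ k′ → Fanout P k → Fanout P k′
Fanout-mono k≤k′ bound {i} p = ≤-trans (bound p) (*-monoʳ-≤ (i + 1) k≤k′)

[m+1]*k+[n+1]*k≤[m+n+1]*[2*k] : ∀ m n k → (m + 1) * k + (n + 1) * k ≤ (m + n + 1) * (2 * k)
[m+1]*k+[n+1]*k≤[m+n+1]*[2*k] m n k =
  subst ((m + 1) * k + (n + 1) * k ≤_) (split m n k) (m≤m+n ((m + 1) * k + (n + 1) * k) ((m + n) * k))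
  where
  split : ∀ m n k → (m + 1) * k + (n + 1) * k + (m + n) * k ≡ (m + n + 1) * (2 * k)
  split = solve-∀

[m+1]*k≤m*[2*k] : ∀ {m} k → 1 ≤ m → (m + 1) * k ≤ m * (2 * k)
[m+1]*k≤m*[2*k] {m} k 1≤m = begin
  (m + 1) * k    ≤⟨ *-monoˡ-≤ k (+-monoʳ-≤ m 1≤m) ⟩
  (m + m) * k    ≡⟨ double m k ⟩
  m * (2 * k)    ∎
  where
  open ≤-Reasoning
  double : ∀ m k → (m + m) * k ≡ m * (2 * k)
  double = solve-∀

∙-fanout : ∀ {P Q k} → Fanout P k → Fanout Q k → Fanout (P ∙ Q) (2 * k)
∙-fanout {k = k} boundP boundQ (_▸_ {i₁} {o₁} {i₂} {o₂} p q) = begin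
  o₁ + o₂                       ≤⟨ +-mono-≤ (boundP p) (boundQ q) ⟩
  (i₁ + 1) * k + (i₂ + 1) * k   ≤⟨ [m+1]*k+[n+1]*k≤[m+n+1]*[2*k] i₁ i₂ k ⟩
  (i₁ + i₂ + 1) * (2 * k)       ∎
  where open ≤-Reasoning

Star-slope : ∀ {P c} → Slope P c → Slope (Star P) c
Star-slope slope []                                     = z≤n
Star-slope {c = c} slope (_∷_ {i₁} {o₁} {i₂} {o₂} p ps) = begin
  o₁ + o₂           ≤⟨ +-mono-≤ (slope p) (Star-slope slope ps) ⟩
  i₁ * c + i₂ * c   ≡⟨ *-distribʳ-+ c i₁ i₂ ⟨
  (i₁ + i₂) * c     ∎
  where open ≤-Reasoning

Star-fanout : ∀ {P k} → Fanout P k → P ⇒ (λ i _ → 1 ≤ i) → Fanout (Star P) (2 * k)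
Star-fanout {k = k} bound positive {i} ps =
  ≤-trans (Star-slope (λ p → ≤-trans (bound p) ([m+1]*k≤m*[2*k] k (positive p))) ps)
          (*-monoˡ-≤ (2 * k) (m≤m+n i 1))

module BoundedOutputClosure (Sg : CommutableSet) where
  open Doubled Sg
  open FreePKAOrder Σ̈

  Profile : Term → Profiles
  Profile 𝟘           _ _ = ⊥
  Profile 𝟙           i o = Unit i o
  Profile (var (x ₗ)) i o = i ≡ 1 × o ≡ 0
  Profile (var (x ᵣ)) i o = i ≡ 0 × o ≡ 1
  Profile (e ⊕ f)     i o = (Profile e ∪ Profile f) i o
  Profile (e ⊙ f)     i o = (Profile e ∙ Profile f) i o
  Profile (e ⋆)       i o = Star (Profile e) i o

  Profile-≈ : ∀ {e f} → e ≈ f → Profile e ⇔ Profile f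
  Profile-≈ ≈-refl              = id , id
  Profile-≈ (≈-sym e≈f)         = swap (Profile-≈ e≈f)
  Profile-≈ (≈-trans e≈f f≈g)   = ⇔-trans (Profile-≈ e≈f) (Profile-≈ f≈g)
  Profile-≈ (⊕-cong e≈e′ f≈f′)  = ∪-cong (Profile-≈ e≈e′) (Profile-≈ f≈f′)
  Profile-≈ (⊙-cong e≈e′ f≈f′)  = ∙-cong (Profile-≈ e≈e′) (Profile-≈ f≈f′)
  Profile-≈ (⋆-cong e≈e′)       = Star-cong (Profile-≈ e≈e′)
  Profile-≈ (⊕-assoc _ _ _)     = assocʳ , assocˡ
  Profile-≈ (⊕-comm _ _)        = Sum.swap , Sum.swap
  Profile-≈ (⊕-idem _)          = reduce , inj₁
  Profile-≈ (⊕-idˡ _)           = fromInj₂ (λ ()) , inj₂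
  Profile-≈ (⊙-assoc _ _ _)     = ∙-assoc
  Profile-≈ (⊙-idˡ _)           = ∙-identityˡ
  Profile-≈ (⊙-idʳ _)           = ∙-identityʳ
  Profile-≈ (distribˡ _ _ _)    = ∙-distribˡ-∪
  Profile-≈ (distribʳ _ _ _)    = ∙-distribʳ-∪
  Profile-≈ (zeroˡ _)           = (λ { (() ▸ _) }) , λ ()
  Profile-≈ (zeroʳ _)           = (λ { (_ ▸ ()) }) , λ ()
  Profile-≈ (⋆-unfold _)        = Star-unfold
  Profile-≈ (comm _)            = ∙-comm , ∙-comm

  Profile-⟦⟧ : ∀ s → Profile ⟦ s ⟧ (length (πₗ s)) (length (πᵣ s))
  Profile-⟦⟧ []          = unit
  Profile-⟦⟧ ((x ₗ) ∷ s) = (refl , refl) ▸ Profile-⟦⟧ s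
  Profile-⟦⟧ ((x ᵣ) ∷ s) = (refl , refl) ▸ Profile-⟦⟧ s

  length-πₗ-++ : ∀ s t → length (πₗ (s ++ t)) ≡ length (πₗ s) + length (πₗ t)
  length-πₗ-++ []          t = refl
  length-πₗ-++ ((x ₗ) ∷ s) t = cong suc (length-πₗ-++ s t)
  length-πₗ-++ ((x ᵣ) ∷ s) t = length-πₗ-++ s t

  length-πᵣ-++ : ∀ s t → length (πᵣ (s ++ t)) ≡ length (πᵣ s) + length (πᵣ t)
  length-πᵣ-++ []          t = refl
  length-πᵣ-++ ((x ₗ) ∷ s) t = length-πᵣ-++ s t
  length-πᵣ-++ ((x ᵣ) ∷ s) t = cong suc (length-πᵣ-++ s t)

  Realized : Term → Profiles
  Realized e i o = ∃ λ s → ⟦ s ⟧ ≤ᵀ e × length (πₗ s) ≡ i × length (πᵣ s) ≡ o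

  Realized-mono : ∀ {e f} → e ≤ᵀ f → Realized e ⇒ Realized f
  Realized-mono e≤f (s , s≤e , refl , refl) = s , ≤ᵀ-trans s≤e e≤f , refl , refl

  Realized-∙ : ∀ {e f} → Realized e ∙ Realized f ⇒ Realized (e ⊙ f)
  Realized-∙ ((s , s≤e , refl , refl) ▸ (t , t≤f , refl , refl)) =
    s ++ t , ≤ᵀ-respˡ-≈ (≈-sym (⟦⟧-++ s t)) (⊙-mono s≤e t≤f) ,
    length-πₗ-++ s t , length-πᵣ-++ s t

  Realized-Star : ∀ {e} → Star (Realized e) ⇒ Realized (e ⋆)
  Realized-Star {e} []       = [] , 𝟙≤⋆ e , refl , refl
  Realized-Star {e} (w ∷ ws) = Realized-mono (x⊙x⋆≤x⋆ e) (Realized-∙ (w ▸ Realized-Star ws))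

  Realized⇒Profile : ∀ e → Realized e ⇒ Profile e
  Realized⇒Profile e (s , s≤e , refl , refl) = proj₁ (Profile-≈ s≤e) (inj₁ (Profile-⟦⟧ s))

  Profile⇒Realized : ∀ e → Profile e ⇒ Realized e
  Profile⇒Realized 𝟘           ()
  Profile⇒Realized 𝟙           unit          = [] , ≤ᵀ-refl 𝟙 , refl , refl
  Profile⇒Realized (var (x ₗ)) (refl , refl) = (x ₗ) ∷ [] , ≤ᵀ-respˡ-≈ (≈-sym (⊙-idʳ _)) (≤ᵀ-refl _) , refl , refl
  Profile⇒Realized (var (x ᵣ)) (refl , refl) = (x ᵣ) ∷ [] , ≤ᵀ-respˡ-≈ (≈-sym (⊙-idʳ _)) (≤ᵀ-refl _) , refl , refl
  Profile⇒Realized (e ⊕ f)     (inj₁ p)      = Realized-mono (x≤x⊕y e f) (Profile⇒Realized e p)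
  Profile⇒Realized (e ⊕ f)     (inj₂ q)      = Realized-mono (y≤x⊕y e f) (Profile⇒Realized f q)
  Profile⇒Realized (e ⊙ f)     pq            = Realized-∙ (∙-map (Profile⇒Realized e) (Profile⇒Realized f) pq)
  Profile⇒Realized (e ⋆)       ps            = Realized-Star (Star-map (Profile⇒Realized e) ps)

  HoldsBelow : Term → Profiles → Set
  HoldsBelow e R = ∀ s → ⟦ s ⟧ ≤ᵀ e → R (length (πₗ s)) (length (πᵣ s))

  HoldsBelow⇒Profile : ∀ e {R} → HoldsBelow e R → Profile e ⇒ R
  HoldsBelow⇒Profile e holds p with Profile⇒Realized e p
  ... | s , s≤e , refl , refl = holds s s≤e

  Profile⇒HoldsBelow : ∀ e {R} → Profile e ⇒ R → HoldsBelow e R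
  Profile⇒HoldsBelow e bound s s≤e = bound (Realized⇒Profile e (s , s≤e , refl , refl))

  HasFanout⇒Fanout : ∀ e {k k′} → k ≤ k′ → HasFanout e k → Fanout (Profile e) k′
  HasFanout⇒Fanout e {k} k≤k′ bound =
    Fanout-mono k≤k′ λ {i} → HoldsBelow⇒Profile e {λ i o → o ≤ (i + 1) * k} bound {i}

  Fanout⇒HasFanout : ∀ e {k} → Fanout (Profile e) k → HasFanout e k
  Fanout⇒HasFanout e {k} = Profile⇒HoldsBelow e {λ i o → o ≤ (i + 1) * k}

  𝟘-boundedOutput : BoundedOutput 𝟘
  𝟘-boundedOutput = 0 , Fanout⇒HasFanout 𝟘 λ ()

  𝟙-boundedOutput : BoundedOutput 𝟙
  𝟙-boundedOutput = 0 , Fanout⇒HasFanout 𝟙 λ { unit → z≤n }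

  ⊕-boundedOutput : ∀ e₁ e₂ → BoundedOutput e₁ → BoundedOutput e₂ → BoundedOutput (e₁ ⊕ e₂)
  ⊕-boundedOutput e₁ e₂ (k₁ , bound₁) (k₂ , bound₂) = k₁ + k₂ , Fanout⇒HasFanout (e₁ ⊕ e₂)
    [ HasFanout⇒Fanout e₁ (m≤m+n k₁ k₂) bound₁ , HasFanout⇒Fanout e₂ (m≤n+m k₂ k₁) bound₂ ]′

  ⊙-boundedOutput : ∀ e₁ e₂ → BoundedOutput e₁ → BoundedOutput e₂ → BoundedOutput (e₁ ⊙ e₂)
  ⊙-boundedOutput e₁ e₂ (k₁ , bound₁) (k₂ , bound₂) = 2 * (k₁ + k₂) , Fanout⇒HasFanout (e₁ ⊙ e₂)
    (∙-fanout (HasFanout⇒Fanout e₁ (m≤m+n k₁ k₂) bound₁) (HasFanout⇒Fanout e₂ (m≤n+m k₂ k₁) bound₂))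

  ⋆-boundedOutput : ∀ e → BoundedOutput e → HoldsBelow e (λ i _ → 1 ≤ i) → BoundedOutput (e ⋆)
  ⋆-boundedOutput e (k , bound) positive = 2 * k , Fanout⇒HasFanout (e ⋆)
    (Star-fanout (HasFanout⇒Fanout e ≤-refl bound) (HoldsBelow⇒Profile e {λ i _ → 1 ≤ i} positive))

mainTheorem15 : (Sg : CommutableSet) → let open Doubled Sg in
    BoundedOutput 𝟘
    × BoundedOutput 𝟙
    × (∀ e₁ e₂ → BoundedOutput e₁ → BoundedOutput e₂ → BoundedOutput (e₁ ⊕ e₂))
    × (∀ e₁ e₂ → BoundedOutput e₁ → BoundedOutput e₂ → BoundedOutput (e₁ ⊙ e₂))
    × (∀ e → BoundedOutput e
           → (∀ (s : List Letter) → ⟦ s ⟧ ≤ᵀ e → 1 ≤ length (πₗ s))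
           → BoundedOutput (e ⋆))
mainTheorem15 Sg =
  𝟘-boundedOutput , 𝟙-boundedOutput , ⊕-boundedOutput , ⊙-boundedOutput , ⋆-boundedOutput
  where open BoundedOutputClosure Sg
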